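{- $t(2,2,2,2)=8$.
   Context: A hypergraph is intersecting if every two of its edges intersect. $\tau(H)$ is the minimum size of a vertex set meeting every edge of $H$. Given a vector $\vec{a}=(a_1,\ldots,a_p)$ of positive integers with $\sum a_i=r$, an $r$-uniform hypergraph $H$ is $\vec{a}$-partitioned if $V(H)=\bigcup_{i\le p}V_i$ with the $V_i$ pairwise disjoint and $|e\cap V_i|=a_i$ for all edges $e$ and all $i$. $t(a_1,\ldots,a_p)$ is the maximum of $\tau(H)$ over all finite intersecting $\vec{a}$-partitioned $r$-uniform hypergraphs $H$. -}

module Defs where

open import Data.Nat using (ℕ; _≤_)
open import Data.Fin using (Fin)
open import Data.Fin.Subset using (Subset; _∩_; ∣_∣; Nonempty; inside; outside)
open import Data.Vec using (Vec; tabulate; lookup; foldr)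
open import Data.List using (List)
open import Data.List.Membership.Propositional using (_∈_)
open import Data.Product using (Σ; _×_; ∃)
open import Relation.Nullary.Decidable using (⌊_⌋)
open import Data.Bool using (if_then_else_)
import Data.Fin as F
import Data.Nat as N
open import Relation.Binary.PropositionalEquality using (_≡_)

record Hypergraph : Set where
  constructor hypergraph
  field
    n     : ℕ
    edges : List (Subset n)
open Hypergraph public

Uniform : ℕ → Hypergraph → Set
Uniform r H = ∀ {e} → e ∈ edges H → ∣ e ∣ ≡ r

Intersecting : Hypergraph → Set
Intersecting H = ∀ {e f} → e ∈ edges H → f ∈ edges H → Nonempty (e ∩ f)

-- the class V_i of a partition given by a map  part : vertices → Fin p
classOf : ∀ {n p} → (Fin n → Fin p) → Fin p → Subset n
classOf part i = tabulate (λ v → if ⌊ part v F.≟ i ⌋ then inside else outside)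

sumVec : ∀ {p} → Vec ℕ p → ℕ
sumVec = foldr _ N._+_ 0

Partitioned : ∀ {p} → Vec ℕ p → Hypergraph → Set
Partitioned {p} a H =
  Uniform (sumVec a) H ×
  Σ (Fin (n H) → Fin p) λ part →
    ∀ {e} → e ∈ edges H → ∀ i → ∣ e ∩ classOf part i ∣ ≡ lookup a i

Cover : (H : Hypergraph) → Subset (n H) → Set
Cover H C = ∀ {e} → e ∈ edges H → Nonempty (C ∩ e)

IsTau : Hypergraph → ℕ → Set
IsTau H k =
  (Σ (Subset (n H)) λ C → Cover H C × ∣ C ∣ ≡ k) ×
  (∀ C → Cover H C → k ≤ ∣ C ∣)

Positive : ∀ {p} → Vec ℕ p → Set
Positive {p} a = ∀ (i : Fin p) → 1 ≤ lookup a i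

IsT : ∀ {p} → Vec ℕ p → ℕ → Set
IsT a k =
  (∀ H → Intersecting H → Partitioned a H → ∀ m → IsTau H m → m ≤ k) ×
  (Σ Hypergraph λ H → Intersecting H × Partitioned a H × IsTau H k)

-- Upper bound: in an intersecting r-uniform hypergraph any single edge meets every edge,
-- so τ ≤ r; a (2,2,2,2)-partitioned hypergraph is 8-uniform (lemma τ≤rank).
--
-- Lower bound: on the 9 × 4 array ℤ₉ × {0,1,2,3} (columns × rows, the rows being the
-- parts) take, for every x ∈ ℤ₉ and every permutation σ of {0,1,2,3}, the edge E(x, σ)
-- consisting of the cells (x , i) and (x + 1 + σ(i) , i) for each row i.  Two such
-- edges meet, because any y ∈ ℤ₉ equals x or differs from x by ±1, …, ±4 (edges-meet).
-- A set C of at most 7 cells has an empty column x whose four following columns contain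
-- at most 3 cells of C (sparseWindow), and a permutation σ avoids 3 given cells of a
-- 4 × 4 array (avoidingPermutation); then E(x, σ) misses C, so τ = 8 (noSmallCover).

module Submission where

open import Defs
open import Data.Vec using (_∷_; [])

open import Data.Bool using (Bool; true; false; _∧_; _∨_; T)
open import Data.Bool.ListAction using (all)
open import Data.Bool.Properties using (T-∧; T-∨; T-≡)
open import Data.Empty using (⊥)
open import Data.Fin as Fin using (Fin; toℕ; #_; combine; remQuot)
open import Data.Fin.Properties using (all?; any?; combine-remQuot)
open import Data.Fin.Subset using (Subset; inside; outside; _∈_; _∉_; _∩_; ∣_∣; Nonempty)
open import Data.Fin.Subset.Properties using (_∈?_; x∈p∩q⁺; x∈p∩q⁻; x∈p⇒∣p-x∣<∣p∣; ∣⊥∣≡0)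
import Data.Fin.Subset as Subset
open import Data.List as List using (List; upTo)
open import Data.List.Membership.Propositional using () renaming (_∈_ to _∈ₗ_)
open import Data.List.Membership.Propositional.Properties using (∈-upTo⁺; ∈-map⁺; ∈-map⁻; ∈-cartesianProduct⁺; ∈-allFin)
open import Data.List.Relation.Unary.All as All using ()
open import Data.List.Relation.Unary.All.Properties using (all⁺)
open import Data.List.Relation.Unary.Any using (here)
open import Data.Nat as ℕ using (ℕ; zero; suc; _+_; _∸_; _≤_; _<_; _≤?_; z≤n; s≤s; s≤s⁻¹)
open import Data.Nat.DivMod using (_mod_)
open import Data.Nat.Properties using (n≮0; ≮⇒≥; m+n≤o⇒m≤o; m+n≤o⇒m≤o∸n; +-comm; ≤-trans)
open import Data.Product using (∃; ∃₂; _×_; _,_; proj₁; proj₂; uncurry)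
open import Data.Sum as Sum using (_⊎_; inj₁; inj₂)
open import Data.Unit using (tt)
open import Data.Vec as Vec using (Vec; lookup; tabulate; concat; group; sum; _++_)
open import Data.Vec.Properties using (lookup-concat; lookup-map; lookup∘tabulate; tabulate-∘; tabulate-cong; []=⇒lookup; lookup⇒[]=)
open import Function using (_∘_; _⇔_; mk⇔; Equivalence)
open import Relation.Binary.PropositionalEquality
open import Relation.Nullary using (Dec; ¬_)
open import Relation.Nullary.Decidable using (⌊_⌋; ¬?; toWitness; fromWitness; _×-dec_; _⊎-dec_)

-- The upper bound τ ≤ r holds for every intersecting r-uniform hypergraph:
-- any edge meets every other edge, so it is a cover of size r.
τ≤rank : ∀ {r} H → Intersecting H → Uniform r H → ∀ m → IsTau H m → m ≤ r
τ≤rank (hypergraph n List.[]) _ _ m (_ , minimal) =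
  ≤-trans (minimal Subset.⊥ (λ ())) (subst (_≤ _) (sym (∣⊥∣≡0 n)) z≤n)
τ≤rank (hypergraph n (e List.∷ _)) intersecting uniform m (_ , minimal) =
  subst (m ≤_) (uniform (here refl)) (minimal e (intersecting (here refl)))

-- A subset of Fin (m * k) is read as an m × k array of cells: the cell (c , i) is the
-- vertex combine c i, and the subset is the concatenation of its m columns.
∈-concat : ∀ {m k} (g : Vec (Subset k) m) c i → combine c i ∈ concat g ⇔ i ∈ lookup g c
∈-concat g c i = mk⇔
  (λ v∈ → lookup⇒[]= i (lookup g c) (trans (sym (lookup-concat g c i)) ([]=⇒lookup v∈)))
  (λ i∈ → lookup⇒[]= (combine c i) (concat g) (trans (lookup-concat g c i) ([]=⇒lookup i∈)))

meet⇒sharedCell : ∀ {m k} (g h : Vec (Subset k) m) → Nonempty (concat g ∩ concat h) →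
                  ∃₂ λ c i → i ∈ lookup g c × i ∈ lookup h c
meet⇒sharedCell {m} {k} g h (v , v∈) = c , i , inColumn g g∋v , inColumn h h∋v
  where
  c = proj₁ (remQuot {m} k v)
  i = proj₂ (remQuot {m} k v)
  inColumn : ∀ f → v ∈ concat f → i ∈ lookup f c
  inColumn f v∈f = Equivalence.to (∈-concat f c i) (subst (_∈ concat f) (sym (combine-remQuot {m} k v)) v∈f)
  g∋v = proj₁ (x∈p∩q⁻ (concat g) (concat h) v∈)
  h∋v = proj₂ (x∈p∩q⁻ (concat g) (concat h) v∈)

sharedCell⇒meet : ∀ {m k} (g h : Vec (Subset k) m) c i → i ∈ lookup g c → i ∈ lookup h c →
                  Nonempty (concat g ∩ concat h)
sharedCell⇒meet g h c i i∈g i∈h =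
  combine c i , x∈p∩q⁺ (Equivalence.from (∈-concat g c i) i∈g , Equivalence.from (∈-concat h c i) i∈h)

∣++∣ : ∀ {m n} (p : Subset m) (q : Subset n) → ∣ p ++ q ∣ ≡ ∣ p ∣ + ∣ q ∣
∣++∣ []          q = refl
∣++∣ (true ∷ p)  q = cong suc (∣++∣ p q)
∣++∣ (false ∷ p) q = ∣++∣ p q

∣concat∣ : ∀ {m k} (g : Vec (Subset k) m) → ∣ concat g ∣ ≡ sum (Vec.map ∣_∣ g)
∣concat∣ []      = refl
∣concat∣ (p ∷ g) = trans (∣++∣ p (concat g)) (cong (∣ p ∣ +_) (∣concat∣ g))

∣p∣≡0⇒∉ : ∀ {n} {p : Subset n} {i} → ∣ p ∣ ≡ 0 → i ∉ p
∣p∣≡0⇒∉ {p = p} size≡0 i∈p = n≮0 (subst (∣ p Subset.- _ ∣ <_) size≡0 (x∈p⇒∣p-x∣<∣p∣ i∈p))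

allSumAtMost : ∀ k → ℕ → (Vec ℕ k → Bool) → Bool
allSumAtMost zero    b f = f []
allSumAtMost (suc k) b f = all (λ a → allSumAtMost k (b ∸ a) (f ∘ (a ∷_))) (upTo (suc b))

allSumAtMost-sound : ∀ k b f → T (allSumAtMost k b f) → ∀ v → sum v ≤ b → T (f v)
allSumAtMost-sound zero    b f ok [] _ = ok
allSumAtMost-sound (suc k) b f ok (a ∷ v) a+v≤b =
  allSumAtMost-sound k (b ∸ a) (f ∘ (a ∷_)) okForA v v≤b∸a
  where
  okForA = All.lookup (all⁺ _ _ ok) (∈-upTo⁺ (s≤s (m+n≤o⇒m≤o a a+v≤b)))
  v≤b∸a = m+n≤o⇒m≤o∸n (sum v) (subst (_≤ b) (+-comm a (sum v)) a+v≤b)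

allSizeAtMost : ∀ n → ℕ → (Subset n → Bool) → Bool
allSizeAtMost zero    b       f = f []
allSizeAtMost (suc n) zero    f = allSizeAtMost n zero (f ∘ (outside ∷_))
allSizeAtMost (suc n) (suc b) f =
  allSizeAtMost n (suc b) (f ∘ (outside ∷_)) ∧ allSizeAtMost n b (f ∘ (inside ∷_))

allSizeAtMost-sound : ∀ n b f → T (allSizeAtMost n b f) → ∀ p → ∣ p ∣ ≤ b → T (f p)
allSizeAtMost-sound zero    b       f ok []          _ = ok
allSizeAtMost-sound (suc n) zero    f ok (false ∷ p) p≤0 =
  allSizeAtMost-sound n zero (f ∘ (outside ∷_)) ok p p≤0
allSizeAtMost-sound (suc n) (suc b) f ok (false ∷ p) p≤b =
  allSizeAtMost-sound n (suc b) (f ∘ (outside ∷_)) (proj₁ (Equivalence.to T-∧ ok)) p p≤b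
allSizeAtMost-sound (suc n) (suc b) f ok (true ∷ p)  (s≤s p≤b) =
  allSizeAtMost-sound n b (f ∘ (inside ∷_)) (proj₂ (Equivalence.to T-∧ ok)) p p≤b

∈-tabulate : ∀ {n} (f : Fin n → Bool) i → i ∈ tabulate f ⇔ T (f i)
∈-tabulate f i = mk⇔
  (λ i∈ → Equivalence.from T-≡ (trans (sym (lookup∘tabulate f i)) ([]=⇒lookup i∈)))
  (λ fi → lookup⇒[]= i (tabulate f) (trans (lookup∘tabulate f i) (Equivalence.to T-≡ fi)))

-- The construction lives on the 9 × 4 array ℤ₉ × Fin 4: a vertex is a cell (c , i)
-- with column c ∈ ℤ₉, and the part V_i of the partition is the i-th row.
ℤ₉ : Set
ℤ₉ = Fin 9

step : ℤ₉ → Fin 4 → ℤ₉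
step x d = (toℕ x + suc (toℕ d)) mod 9

ℤ₉-trichotomy : ∀ x y → y ≡ x ⊎ (∃ λ d → y ≡ step x d) ⊎ (∃ λ d → x ≡ step y d)
ℤ₉-trichotomy = toWitness {a? = all? λ x → all? λ y →
  (y Fin.≟ x) ⊎-dec (any? λ d → y Fin.≟ step x d) ⊎-dec (any? λ d → x Fin.≟ step y d)} tt

Perm : Set
Perm = Fin 24

permutations : Vec (Vec (Fin 4) 4) 24
permutations =
  (# 0 ∷ # 1 ∷ # 2 ∷ # 3 ∷ []) ∷ (# 0 ∷ # 1 ∷ # 3 ∷ # 2 ∷ []) ∷ (# 0 ∷ # 2 ∷ # 1 ∷ # 3 ∷ []) ∷
  (# 0 ∷ # 2 ∷ # 3 ∷ # 1 ∷ []) ∷ (# 0 ∷ # 3 ∷ # 1 ∷ # 2 ∷ []) ∷ (# 0 ∷ # 3 ∷ # 2 ∷ # 1 ∷ []) ∷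
  (# 1 ∷ # 0 ∷ # 2 ∷ # 3 ∷ []) ∷ (# 1 ∷ # 0 ∷ # 3 ∷ # 2 ∷ []) ∷ (# 1 ∷ # 2 ∷ # 0 ∷ # 3 ∷ []) ∷
  (# 1 ∷ # 2 ∷ # 3 ∷ # 0 ∷ []) ∷ (# 1 ∷ # 3 ∷ # 0 ∷ # 2 ∷ []) ∷ (# 1 ∷ # 3 ∷ # 2 ∷ # 0 ∷ []) ∷
  (# 2 ∷ # 0 ∷ # 1 ∷ # 3 ∷ []) ∷ (# 2 ∷ # 0 ∷ # 3 ∷ # 1 ∷ []) ∷ (# 2 ∷ # 1 ∷ # 0 ∷ # 3 ∷ []) ∷
  (# 2 ∷ # 1 ∷ # 3 ∷ # 0 ∷ []) ∷ (# 2 ∷ # 3 ∷ # 0 ∷ # 1 ∷ []) ∷ (# 2 ∷ # 3 ∷ # 1 ∷ # 0 ∷ []) ∷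
  (# 3 ∷ # 0 ∷ # 1 ∷ # 2 ∷ []) ∷ (# 3 ∷ # 0 ∷ # 2 ∷ # 1 ∷ []) ∷ (# 3 ∷ # 1 ∷ # 0 ∷ # 2 ∷ []) ∷
  (# 3 ∷ # 1 ∷ # 2 ∷ # 0 ∷ []) ∷ (# 3 ∷ # 2 ∷ # 0 ∷ # 1 ∷ []) ∷ (# 3 ∷ # 2 ∷ # 1 ∷ # 0 ∷ []) ∷ []

_⟨$⟩_ : Perm → Fin 4 → Fin 4
σ ⟨$⟩ i = lookup (lookup permutations σ) i

perm-onto : ∀ σ d → ∃ λ i → σ ⟨$⟩ i ≡ d
perm-onto = toWitness {a? = all? λ σ → all? λ d → any? λ i → σ ⟨$⟩ i Fin.≟ d} tt

inEdge : ℤ₉ → Perm → ℤ₉ → Fin 4 → Bool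
inEdge x σ c i = ⌊ c Fin.≟ x ⌋ ∨ ⌊ c Fin.≟ step x (σ ⟨$⟩ i) ⌋

edgeColumns : ℤ₉ → Perm → Vec (Subset 4) 9
edgeColumns x σ = tabulate λ c → tabulate (inEdge x σ c)

edge : ℤ₉ → Perm → Subset (9 ℕ.* 4)
edge x σ = concat (edgeColumns x σ)

∈-edgeColumns : ∀ x σ c i → i ∈ lookup (edgeColumns x σ) c ⇔ (c ≡ x ⊎ c ≡ step x (σ ⟨$⟩ i))
∈-edgeColumns x σ c i = mk⇔
  (λ i∈ → Sum.map (toWitness {a? = atBase}) (toWitness {a? = atTip})
                  (Equivalence.to (T-∨ {⌊ atBase ⌋}) (Equivalence.to ∈column (subst (i ∈_) column≡ i∈))))
  (λ cases → subst (i ∈_) (sym column≡) (Equivalence.from ∈column (Equivalence.from (T-∨ {⌊ atBase ⌋})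
                  (Sum.map (fromWitness {a? = atBase}) (fromWitness {a? = atTip}) cases))))
  where
  atBase = c Fin.≟ x
  atTip  = c Fin.≟ step x (σ ⟨$⟩ i)
  column≡ = lookup∘tabulate (λ c → tabulate (inEdge x σ c)) c
  ∈column = ∈-tabulate (inEdge x σ c) i

edgeIndices : List (ℤ₉ × Perm)
edgeIndices = List.cartesianProduct (List.allFin 9) (List.allFin 24)

H₉ : Hypergraph
H₉ = hypergraph (9 ℕ.* 4) (List.map (uncurry edge) edgeIndices)

edge∈H₉ : ∀ x σ → edge x σ ∈ₗ edges H₉
edge∈H₉ x σ = ∈-map⁺ (uncurry edge) (∈-cartesianProduct⁺ (∈-allFin x) (∈-allFin σ))

H₉-edge-induction : (P : Subset (9 ℕ.* 4) → Set) → (∀ x σ → P (edge x σ)) → ∀ {e} → e ∈ₗ edges H₉ → P e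
H₉-edge-induction P P-edge {e} e∈ = fromIndex (∈-map⁻ (uncurry edge) {xs = edgeIndices} e∈)
  where
  fromIndex : (∃ λ p → p ∈ₗ edgeIndices × e ≡ uncurry edge p) → P e
  fromIndex ((x , σ) , _ , e≡) = subst P (sym e≡) (P-edge x σ)

row : Fin (9 ℕ.* 4) → Fin 4
row v = proj₂ (remQuot {9} 4 v)

edge-sizes : ∀ x σ → ∣ edge x σ ∣ ≡ 8 × (∀ i → ∣ edge x σ ∩ classOf row i ∣ ≡ lookup (2 ∷ 2 ∷ 2 ∷ 2 ∷ []) i)
edge-sizes = toWitness {a? = all? λ x → all? λ σ →
  (∣ edge x σ ∣ ℕ.≟ 8) ×-dec (all? λ i → ∣ edge x σ ∩ classOf row i ∣ ℕ.≟ lookup (2 ∷ 2 ∷ 2 ∷ 2 ∷ []) i)} tt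

H₉-partitioned : Partitioned (2 ∷ 2 ∷ 2 ∷ 2 ∷ []) H₉
H₉-partitioned =
  H₉-edge-induction (λ e → ∣ e ∣ ≡ 8) (λ x σ → proj₁ (edge-sizes x σ)) ,
  row ,
  λ e∈ i → H₉-edge-induction (λ e → ∣ e ∩ classOf row i ∣ ≡ lookup (2 ∷ 2 ∷ 2 ∷ 2 ∷ []) i)
                     (λ x σ → proj₂ (edge-sizes x σ) i) e∈

cell-on-both : ∀ x σ y π c i → c ≡ x ⊎ c ≡ step x (σ ⟨$⟩ i) → c ≡ y ⊎ c ≡ step y (π ⟨$⟩ i) →
               Nonempty (edge x σ ∩ edge y π)
cell-on-both x σ y π c i onE onF = sharedCell⇒meet (edgeColumns x σ) (edgeColumns y π) c i
  (Equivalence.from (∈-edgeColumns x σ c i) onE) (Equivalence.from (∈-edgeColumns y π c i) onF)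

-- Two edges E(x, σ) and E(y, π) meet: if y = x they share column x; if y = x + 1 + d
-- they share the cell (y , σ⁻¹(d)); if x = y + 1 + d they share (x , π⁻¹(d)).
edges-meet : ∀ x σ y π → Nonempty (edge x σ ∩ edge y π)
edges-meet x σ y π = byPosition (ℤ₉-trichotomy x y)
  where
  byPosition : y ≡ x ⊎ (∃ λ d → y ≡ step x d) ⊎ (∃ λ d → x ≡ step y d) → Nonempty (edge x σ ∩ edge y π)
  byPosition (inj₁ y≡x) = cell-on-both x σ y π y (# 0) (inj₁ y≡x) (inj₁ refl)
  byPosition (inj₂ (inj₁ (d , y≡x+d))) =
    let i , σi≡d = perm-onto σ d
    in cell-on-both x σ y π y i (inj₂ (trans y≡x+d (cong (step x) (sym σi≡d)))) (inj₁ refl)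
  byPosition (inj₂ (inj₂ (d , x≡y+d))) =
    let i , πi≡d = perm-onto π d
    in cell-on-both x σ y π x i (inj₁ refl) (inj₂ (trans x≡y+d (cong (step y) (sym πi≡d))))

H₉-intersecting : Intersecting H₉
H₉-intersecting {f = f} e∈ f∈ =
  H₉-edge-induction (λ e → Nonempty (e ∩ f))
    (λ x σ → H₉-edge-induction (λ f → Nonempty (edge x σ ∩ f)) (edges-meet x σ) f∈) e∈

window : ∀ {A : Set} → Vec A 9 → ℤ₉ → Vec A 4
window v x = tabulate λ d → lookup v (step x d)

window-map : ∀ {A B : Set} (f : A → B) v x → window (Vec.map f v) x ≡ Vec.map f (window v x)
window-map f v x = trans (tabulate-cong λ d → lookup-map (step x d) f v) (tabulate-∘ f (λ d → lookup v (step x d)))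

opaque
  sparseWindow : ∀ (ns : Vec ℕ 9) → sum ns ≤ 7 → ∃ λ x → lookup ns x ≡ 0 × sum (window ns x) ≤ 3
  sparseWindow ns atMost7 = toWitness (allSumAtMost-sound 9 7 (λ ns → ⌊ sparseWindow? ns ⌋) tt ns atMost7)
    where
    sparseWindow? : ∀ ns → Dec (∃ λ x → lookup ns x ≡ 0 × sum (window ns x) ≤ 3)
    sparseWindow? ns = any? λ x → (lookup ns x ℕ.≟ 0) ×-dec (sum (window ns x) ≤? 3)

-- In a 4 × 4 array with at most 3 marked cells some permutation avoids every mark: a cell
-- lies on 6 of the 24 permutations and 3 · 6 < 24 (checked over every such array).
opaque
  avoidingPermutation : ∀ (p : Subset (4 ℕ.* 4)) → ∣ p ∣ ≤ 3 → ∃ λ σ → ∀ i → combine (σ ⟨$⟩ i) i ∉ p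
  avoidingPermutation p atMost3 = toWitness (allSizeAtMost-sound 16 3 (λ p → ⌊ avoiding? p ⌋) tt p atMost3)
    where
    avoiding? : ∀ p → Dec (∃ λ σ → ∀ i → combine (σ ⟨$⟩ i) i ∉ p)
    avoiding? p = any? λ σ → all? λ i → ¬? (combine (σ ⟨$⟩ i) i ∈? p)

-- H₉ has no cover C with fewer than 8 vertices: read C as nine columns, take an empty
-- column x whose window holds at most 3 vertices of C, and a permutation σ avoiding them;
-- then the edge E(x, σ) misses C.
noSmallCover : ∀ C → Cover H₉ C → ¬ ∣ C ∣ < 8
noSmallCover C cover ∣C∣<8 = missed (meet⇒sharedCell columns (edgeColumns x σ) meets)
  where
  columns = proj₁ (group 9 4 C)
  C≡columns : C ≡ concat columns
  C≡columns = proj₂ (group 9 4 C)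
  sizes = Vec.map ∣_∣ columns
  sizes≤7 : sum sizes ≤ 7
  sizes≤7 = subst (_≤ 7) (trans (cong ∣_∣ C≡columns) (∣concat∣ columns)) (s≤s⁻¹ ∣C∣<8)

  sparse = sparseWindow sizes sizes≤7
  x = proj₁ sparse
  ahead = window columns x
  ahead≤3 : ∣ concat ahead ∣ ≤ 3
  ahead≤3 = subst (_≤ 3) (sym (trans (∣concat∣ ahead) (cong sum (sym (window-map ∣_∣ columns x)))))
                  (proj₂ (proj₂ sparse))

  avoiding = avoidingPermutation (concat ahead) ahead≤3
  σ = proj₁ avoiding

  offEdge : ∀ c i → c ≡ x ⊎ c ≡ step x (σ ⟨$⟩ i) → i ∉ lookup columns c
  offEdge c i (inj₁ c≡x) = subst (λ c → i ∉ lookup columns c) (sym c≡x)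
    (∣p∣≡0⇒∉ (trans (sym (lookup-map x ∣_∣ columns)) (proj₁ (proj₂ sparse))))
  offEdge c i (inj₂ c≡tip) = subst (λ c → i ∉ lookup columns c) (sym c≡tip)
    (subst (i ∉_) (lookup∘tabulate (λ d → lookup columns (step x d)) (σ ⟨$⟩ i))
      (proj₂ avoiding i ∘ Equivalence.from (∈-concat ahead (σ ⟨$⟩ i) i)))

  meets : Nonempty (concat columns ∩ edge x σ)
  meets = subst (λ C → Nonempty (C ∩ edge x σ)) C≡columns (cover (edge∈H₉ x σ))
  missed : (∃₂ λ c i → i ∈ lookup columns c × i ∈ lookup (edgeColumns x σ) c) → ⊥
  missed (c , i , inC , inE) = offEdge c i (Equivalence.to (∈-edgeColumns x σ c i) inE) inC

H₉-τ : IsTau H₉ 8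
H₉-τ = (edge Fin.zero Fin.zero , H₉-intersecting (edge∈H₉ Fin.zero Fin.zero) , proj₁ (edge-sizes Fin.zero Fin.zero)) ,
       λ C cover → ≮⇒≥ (noSmallCover C cover)

mainTheorem7 : IsT (2 ∷ 2 ∷ 2 ∷ 2 ∷ []) 8
mainTheorem7 =
  (λ H intersecting partitioned → τ≤rank H intersecting (proj₁ partitioned)) ,
  H₉ , H₉-intersecting , H₉-partitioned , H₉-τ
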